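{- Let $\phi$ be a 3-CNF formula with variables $x_1,\ldots,x_n$ and clauses $C_1,\ldots,C_m$. Construct a graph $G$ as follows. For each variable $x_i$ add a triangle on three new vertices $x_i, t_i, f_i$. For each clause $C_j$ add a vertex $c_j$; if $x_i$ occurs positively in $C_j$ add the edge $c_j t_i$, and if $x_i$ occurs negatively in $C_j$ add the edge $c_j f_i$. Add a vertex $y_1$ adjacent to every $c_j$ ($1\le j\le m$), and two further vertices $y_2,y_3$ with edges $y_1y_2$ and $y_2y_3$. Let $X := \{x_1,\ldots,x_n,y_1\}$. Then $\phi$ is satisfiable if and only if $G$ has a dominating set of size $|X|$.
   Context: A dominating set of a graph $G$ is a set $D\subseteq V(G)$ such that every vertex of $G$ is in $D$ or has a neighbour in $D$. -}

module Defs where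

open import Data.Nat using (ℕ; suc)
open import Data.Fin using (Fin)
open import Data.Bool using (Bool; true; false)
open import Data.Product using (_×_; _,_; ∃)
open import Data.Sum using (_⊎_)
open import Data.Vec using (Vec)
open import Data.Vec.Membership.Propositional using () renaming (_∈_ to _∈ᵥ_)
open import Data.List using (List; length)
open import Data.List.Membership.Propositional using (_∈_)
open import Data.List.Relation.Unary.Any using (Any)
open import Data.List.Relation.Unary.Unique.Propositional using (Unique)
open import Relation.Binary.PropositionalEquality using (_≡_)

-- A literal over variables x_0..x_{n-1}: (variable, polarity);
-- polarity true = positive occurrence x_i, false = negative occurrence ¬x_i.
Literal : ℕ → Set
Literal n = Fin n × Bool

CNF3 : ℕ → ℕ → Set
CNF3 n m = Fin m → Vec (Literal n) 3

Assignment : ℕ → Set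
Assignment n = Fin n → Bool

LitTrue : ∀ {n} → Assignment n → Literal n → Set
LitTrue α (i , b) = α i ≡ b

Satisfies : ∀ {n m} → Assignment n → CNF3 n m → Set
Satisfies {n} {m} α φ = (j : Fin m) → ∃ λ (l : Literal n) → l ∈ᵥ φ j × LitTrue α l

Satisfiable : ∀ {n m} → CNF3 n m → Set
Satisfiable {n} φ = ∃ λ (α : Assignment n) → Satisfies α φ

data Vertex (n m : ℕ) : Set where
  x t f : Fin n → Vertex n m
  c     : Fin m → Vertex n m
  y₁ y₂ y₃ : Vertex n m

data Edge {n m : ℕ} (φ : CNF3 n m) : Vertex n m → Vertex n m → Set where
  xt   : ∀ i → Edge φ (x i) (t i)
  tf   : ∀ i → Edge φ (t i) (f i)
  xf   : ∀ i → Edge φ (x i) (f i)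
  ct   : ∀ j i → (i , true) ∈ᵥ φ j → Edge φ (c j) (t i)
  cf   : ∀ j i → (i , false) ∈ᵥ φ j → Edge φ (c j) (f i)
  y₁c  : ∀ j → Edge φ y₁ (c j)
  y₁y₂ : Edge φ y₁ y₂
  y₂y₃ : Edge φ y₂ y₃

Adj : ∀ {n m} (φ : CNF3 n m) → Vertex n m → Vertex n m → Set
Adj φ u v = Edge φ u v ⊎ Edge φ v u

Dominating : ∀ {n m} (φ : CNF3 n m) → List (Vertex n m) → Set
Dominating {n} {m} φ D = (v : Vertex n m) → v ∈ D ⊎ Any (Adj φ v) D

HasDominatingSetOfSize : ∀ {n m} (φ : CNF3 n m) → ℕ → Set
HasDominatingSetOfSize {n} {m} φ k =
  ∃ λ (D : List (Vertex n m)) → Unique D × length D ≡ k × Dominating φ D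

-- X = {x_1,…,x_n, y_1}, so |X| = n + 1.

-- A list D dominates G iff it meets the closed neighbourhood N[v] of every
-- vertex v.  The closed neighbourhoods of the n + 1 "anchors" y₃, x₁, …, xₙ
-- are pairwise disjoint: N[y₃] = {y₂,y₃} and N[xᵢ] = {xᵢ,tᵢ,fᵢ}.
--
-- (⇒) From a satisfying assignment α take y₂ together with tᵢ or fᵢ
--     according to α(xᵢ); a clause vertex cⱼ is dominated by the vertex of
--     any of its true literals.
-- (⇐) A general pigeonhole fact (module Transversal): a list of at most k
--     elements meeting k pairwise disjoint classes has every element in
--     some class, and at most one element per class.  Applied to the anchor
--     neighbourhoods, a dominating set of size n + 1 contains no clause
--     vertex and not y₁, and exactly one of xᵢ, tᵢ, fᵢ for each i.  Setting
--     α(xᵢ) := "that vertex is tᵢ", the neighbour of cⱼ in D is tᵢ or fᵢ for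
--     a literal of Cⱼ, which α therefore makes true.
module Submission where

open import Defs
open import Data.Nat using (ℕ; suc; _≤_)
open import Data.Nat.Properties using (≤-trans; ≤-reflexive; 1+n≰n)
open import Data.Fin using (Fin; zero; suc)
open import Data.Fin.Properties using (injective⇒≤; any?; _≟_)
open import Data.Bool using (Bool; true; false)
open import Data.Maybe using (Maybe; just; nothing)
open import Data.Maybe.Properties using (just-injective)
open import Data.Product using (_×_; _,_; ∃)
open import Data.Sum using (_⊎_; inj₁; inj₂)
open import Data.Empty using (⊥-elim)
open import Data.List using (List; _∷_; length; lookup; map; allFin)
open import Data.List.Properties using (length-map; length-tabulate)
open import Data.List.Relation.Unary.Any as Any using (Any; here; there)
open import Data.List.Relation.Unary.Any.Properties using (lookup-index; Any-⊎⁺; Any-⊎⁻)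
import Data.List.Relation.Unary.All as All
import Data.List.Relation.Unary.All.Properties as AllProperties
open import Data.List.Relation.Unary.Unique.Propositional using (Unique)
import Data.List.Relation.Unary.AllPairs as AllPairs
import Data.List.Relation.Unary.Unique.Propositional.Properties as Unique
open import Data.List.Membership.Propositional using (_∈_; _∉_; find)
open import Data.List.Membership.Propositional.Properties using (∈-map⁺; ∈-allFin)
open import Data.Vec.Membership.Propositional using () renaming (_∈_ to _∈ᵥ_)
open import Function.Base using (_∘_)
open import Function.Bundles using (_⇔_; mk⇔; module Equivalence)
open import Function.Definitions using (Injective)
open import Relation.Binary.PropositionalEquality
open import Relation.Nullary using (yes; no; contradiction)

-- Finite pigeonhole: an injection Fin m → Fin n with n ≤ m is onto.  If p
-- were missed, sending a new point to p would inject Fin (suc m) into Fin n.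
injective⇒surjective : ∀ {m n} {r : Fin m → Fin n} → Injective _≡_ _≡_ r →
                       n ≤ m → ∀ p → ∃ λ i → r i ≡ p
injective⇒surjective {m} {n} {r} r-inj n≤m p with any? (λ i → r i ≟ p)
... | yes hit  = hit
... | no  miss = contradiction (≤-trans (injective⇒≤ extend-injective) n≤m) 1+n≰n
  where
  extend : Fin (suc m) → Fin n
  extend zero    = p
  extend (suc i) = r i

  extend-injective : Injective _≡_ _≡_ extend
  extend-injective {zero}  {zero}  _ = refl
  extend-injective {zero}  {suc j} e = ⊥-elim (miss (j , sym e))
  extend-injective {suc i} {zero}  e = ⊥-elim (miss (i , e))
  extend-injective {suc i} {suc j} e = cong suc (r-inj e)

module Transversal {a p} {A : Set a} {k : ℕ} (P : Fin k → A → Set p)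
  (disjoint : ∀ {i j v} → P i v → P j v → i ≡ j)
  (D : List A) (short : length D ≤ k) (meets : ∀ i → Any (P i) D) where

  private
    rep : Fin k → Fin (length D)
    rep i = Any.index (meets i)

    rep-in : ∀ i → P i (lookup D (rep i))
    rep-in i = lookup-index (meets i)

    rep-injective : Injective _≡_ _≡_ rep
    rep-injective {i} {j} e = disjoint (rep-in i) (subst (P j ∘ lookup D) (sym e) (rep-in j))

    member-is-rep : ∀ {v} (v∈D : v ∈ D) → ∃ λ i → P i v × rep i ≡ Any.index v∈D
    member-is-rep v∈D with i , rep≡ ← injective⇒surjective rep-injective short (Any.index v∈D) =
      i , subst (P i) (sym (lookup-index v∈D)) (subst (P i ∘ lookup D) rep≡ (rep-in i)) , rep≡

    position : ∀ {i v} (v∈D : v ∈ D) → P i v → Any.index v∈D ≡ rep i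
    position v∈D Pv with j , Pjv , rep≡ ← member-is-rep v∈D =
      subst (λ j → Any.index v∈D ≡ rep j) (disjoint Pjv Pv) (sym rep≡)

  classified : ∀ {v} → v ∈ D → ∃ λ i → P i v
  classified v∈D with i , Piv , _ ← member-is-rep v∈D = i , Piv

  one-per-class : ∀ {i u v} → u ∈ D → v ∈ D → P i u → P i v → u ≡ v
  one-per-class {i} {u} {v} u∈D v∈D Pu Pv = begin
    u                           ≡⟨ lookup-index u∈D ⟩
    lookup D (Any.index u∈D)    ≡⟨ cong (lookup D) (position u∈D Pu) ⟩
    lookup D (rep i)            ≡⟨ cong (lookup D) (sym (position v∈D Pv)) ⟩
    lookup D (Any.index v∈D)    ≡⟨ sym (lookup-index v∈D) ⟩
    v                           ∎
    where open ≡-Reasoning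

module _ {n m : ℕ} (φ : CNF3 n m) where

  N[_] : Vertex n m → Vertex n m → Set
  N[ v ] u = v ≡ u ⊎ Adj φ v u

  dominating⇔meets-all : ∀ D → Dominating φ D ⇔ (∀ v → Any N[ v ] D)
  dominating⇔meets-all D = mk⇔ (λ dom v → Any-⊎⁺ (dom v)) (λ meets v → Any-⊎⁻ (meets v))

  anchor : Fin (suc n) → Vertex n m
  anchor zero    = y₃
  anchor (suc i) = x i

  gadget : Vertex n m → Maybe (Fin (suc n))
  gadget (x i) = just (suc i)
  gadget (t i) = just (suc i)
  gadget (f i) = just (suc i)
  gadget (c _) = nothing
  gadget y₁    = nothing
  gadget y₂    = just zero
  gadget y₃    = just zero

  -- N[anchor k] lies inside gadget k; hence the anchor neighbourhoods are
  -- pairwise disjoint and avoid clause vertices and y₁.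
  anchor-nbhd⊆gadget : ∀ k {u} → N[ anchor k ] u → gadget u ≡ just k
  anchor-nbhd⊆gadget zero    (inj₁ refl)          = refl
  anchor-nbhd⊆gadget zero    (inj₂ (inj₂ y₂y₃))   = refl
  anchor-nbhd⊆gadget (suc i) (inj₁ refl)          = refl
  anchor-nbhd⊆gadget (suc i) (inj₂ (inj₁ (xt i))) = refl
  anchor-nbhd⊆gadget (suc i) (inj₂ (inj₁ (xf i))) = refl

  anchor-nbhds-disjoint : ∀ {i j u} → N[ anchor i ] u → N[ anchor j ] u → i ≡ j
  anchor-nbhds-disjoint {i} {j} Nᵢ Nⱼ =
    just-injective (trans (sym (anchor-nbhd⊆gadget i Nᵢ)) (anchor-nbhd⊆gadget j Nⱼ))

  literal-vertex : Literal n → Vertex n m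
  literal-vertex (i , true)  = t i
  literal-vertex (i , false) = f i

  literal-vertex-variable : ∀ {i j b b′} →
    literal-vertex (i , b) ≡ literal-vertex (j , b′) → i ≡ j
  literal-vertex-variable {b = true}  {true}  refl = refl
  literal-vertex-variable {b = false} {false} refl = refl

  literal-vertex-covers-x : ∀ i b → N[ x i ] (literal-vertex (i , b))
  literal-vertex-covers-x i true  = inj₂ (inj₁ (xt i))
  literal-vertex-covers-x i false = inj₂ (inj₁ (xf i))

  literal-vertex-covers-t : ∀ i b → N[ t i ] (literal-vertex (i , b))
  literal-vertex-covers-t i true  = inj₁ refl
  literal-vertex-covers-t i false = inj₂ (inj₁ (tf i))

  literal-vertex-covers-f : ∀ i b → N[ f i ] (literal-vertex (i , b))
  literal-vertex-covers-f i true  = inj₂ (inj₂ (tf i))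
  literal-vertex-covers-f i false = inj₁ refl

  literal-vertex-covers-c : ∀ j {l} → l ∈ᵥ φ j → N[ c j ] (literal-vertex l)
  literal-vertex-covers-c j {i , true}  l∈Cⱼ = inj₂ (inj₁ (ct j i l∈Cⱼ))
  literal-vertex-covers-c j {i , false} l∈Cⱼ = inj₂ (inj₁ (cf j i l∈Cⱼ))

  module FromAssignment (α : Assignment n) (sat : Satisfies α φ) where
    chosen : Fin n → Vertex n m
    chosen i = literal-vertex (i , α i)

    D : List (Vertex n m)
    D = y₂ ∷ map chosen (allFin n)

    chosen∈D : ∀ i → chosen i ∈ D
    chosen∈D i = there (∈-map⁺ chosen (∈-allFin i))

    -- y₂ is no literal vertex, and different variables give different literal vertices.
    unique : Unique D
    unique = AllProperties.map⁺ (All.tabulate λ {i} _ → y₂≢literal (α i))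
           AllPairs.∷ Unique.map⁺ literal-vertex-variable (Unique.allFin⁺ n)
      where
      y₂≢literal : ∀ {i} b → y₂ ≢ literal-vertex (i , b)
      y₂≢literal true  ()
      y₂≢literal false ()

    size : length D ≡ suc n
    size = cong suc (trans (length-map chosen (allFin n)) (length-tabulate (λ i → i)))

    -- A true literal of Cⱼ has its vertex in D.
    clause-covered : ∀ j → Any N[ c j ] D
    clause-covered j with (i , _) , l∈Cⱼ , refl ← sat j =
      Any.map (λ { refl → literal-vertex-covers-c j l∈Cⱼ }) (chosen∈D i)

    meets-all : ∀ v → Any N[ v ] D
    meets-all (x i) = Any.map (λ { refl → literal-vertex-covers-x i (α i) }) (chosen∈D i)
    meets-all (t i) = Any.map (λ { refl → literal-vertex-covers-t i (α i) }) (chosen∈D i)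
    meets-all (f i) = Any.map (λ { refl → literal-vertex-covers-f i (α i) }) (chosen∈D i)
    meets-all (c j) = clause-covered j
    meets-all y₁    = here (inj₂ (inj₁ y₁y₂))
    meets-all y₂    = here (inj₁ refl)
    meets-all y₃    = here (inj₂ (inj₂ y₂y₃))

    dominating : Dominating φ D
    dominating = Equivalence.from (dominating⇔meets-all D) meets-all

  module FromDominatingSet (D : List (Vertex n m)) (size : length D ≡ suc n)
                           (dom : Dominating φ D) where
    meets-all : ∀ v → Any N[ v ] D
    meets-all = Equivalence.to (dominating⇔meets-all D) dom

    open Transversal (λ k → N[ anchor k ]) anchor-nbhds-disjoint D
                     (≤-reflexive size) (λ k → meets-all (anchor k))

    outside-gadgets : ∀ {v} → gadget v ≡ nothing → v ∉ D
    outside-gadgets {v} none v∈D with k , N ← classified v∈D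
      with () ← trans (sym none) (anchor-nbhd⊆gadget k N)

    representative : Fin n → Vertex n m
    representative i with v , _ ← find (meets-all (x i)) = v

    representative-unique : ∀ {i v} → v ∈ D → N[ x i ] v → representative i ≡ v
    representative-unique {i} v∈D N with w , w∈D , Nw ← find (meets-all (x i)) =
      one-per-class {suc i} w∈D v∈D Nw N

    is-t : Vertex n m → Bool
    is-t (t _) = true
    is-t _     = false

    α : Assignment n
    α i = is-t (representative i)

    clause-satisfied : ∀ j {w} → w ∈ D → Adj φ (c j) w →
                       ∃ λ (l : Literal n) → l ∈ᵥ φ j × LitTrue α l
    clause-satisfied j t∈D (inj₁ (ct j i l∈Cⱼ)) =
      (i , true) , l∈Cⱼ , cong is-t (representative-unique t∈D (inj₂ (inj₁ (xt i))))
    clause-satisfied j f∈D (inj₁ (cf j i l∈Cⱼ)) =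
      (i , false) , l∈Cⱼ , cong is-t (representative-unique f∈D (inj₂ (inj₁ (xf i))))
    clause-satisfied j y₁∈D (inj₂ (y₁c j)) = ⊥-elim (outside-gadgets refl y₁∈D)

    satisfies : Satisfies α φ
    satisfies j with dom (c j)
    ... | inj₁ c∈D = ⊥-elim (outside-gadgets refl c∈D)
    ... | inj₂ adj with w , w∈D , c~w ← find adj = clause-satisfied j w∈D c~w

lemma4 : (n m : ℕ) (φ : CNF3 n m) →
    Satisfiable φ ⇔ HasDominatingSetOfSize φ (suc n)
lemma4 n m φ = mk⇔
  (λ { (α , sat) → let open FromAssignment φ α sat in D , unique , size , dominating })
  (λ { (D , _ , size , dom) → let open FromDominatingSet φ D size dom in α , satisfies })
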